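{- There is a formula $\phi(x,y)$ of $\mathsf{InqBT}$ in the empty vocabulary (only identity), with free variables $x,y$, for which there is no first-order sentence $\phi^*(R)$ over the vocabulary $\{R\}$, $R$ a binary relation symbol, such that for all models $\mathcal{M}$ and all teams $X$ with domain $\{x,y\}$: $\mathcal{M}\models_X\phi(x,y)$ iff $(\mathcal{M},X[x,y])\models\phi^*(R)$.
   Context: Syntax of $\mathsf{InqBT}$: $\phi ::= p \mid \bot \mid (\phi\wedge\phi)\mid(\phi\veebar\phi)\mid(\phi\to\phi)\mid\forall x\phi\mid\exists^{\mathrm{i}}x\phi$, with $p$ first-order atoms. Models $\mathcal{M}=(D,I)$ are ordinary first-order structures; a team $X$ is a set of assignments with a common variable domain; $X[x\mapsto d]=\{g[x\mapsto d]: g\in X\}$. Support $\mathcal{M}\models_X\phi$: atoms iff true under every $g\in X$; $\bot$ iff $X=\emptyset$; $\wedge$ conjunction; $\phi\veebar\psi$ iff $\phi$ or $\psi$ supported; $\phi\to\psi$ iff every $Y\subseteq X$ supporting $\phi$ supports $\psi$; $\forall x\phi$ iff $X[x\mapsto d]$ supports $\phi$ for all $d\in D$; $\exists^{\mathrm{i}}x\phi$ iff $X[x\mapsto d]$ supports $\phi$ for some $d\in D$. For a team $X$ with $x,y\in\mathrm{dom}(X)$, $X[x,y]=\{(g(x),g(y)): g\in X\}\subseteq D^2$, and $(\mathcal{M},X[x,y])$ is the expansion of $\mathcal{M}$ interpreting $R$ as $X[x,y]$. -}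

module Defs where

open import Level using (Lift; lift)
open import Data.Nat using (ℕ; suc)
open import Data.Fin using (Fin; zero; suc)
open import Data.Vec using (Vec; _∷_; []; lookup)
open import Data.Product using (Σ; _×_; _,_)
open import Data.Sum using (_⊎_)
open import Data.Empty using (⊥)
open import Relation.Nullary using (¬_)
open import Relation.Binary.PropositionalEquality using (_≡_)

-- Variables are de Bruijn indices: a formula in context n has free
-- variables among Fin n; a quantifier binds the new variable `zero`.

data InqBT (n : ℕ) : Set where
  ident : Fin n → Fin n → InqBT n
  bot   : InqBT n
  _∧ᵢ_  : InqBT n → InqBT n → InqBT n
  _⊻ᵢ_  : InqBT n → InqBT n → InqBT n
  _⇒ᵢ_  : InqBT n → InqBT n → InqBT n
  allᵢ  : InqBT (suc n) → InqBT n
  exiᵢ  : InqBT (suc n) → InqBT n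

Team : Set → ℕ → Set₁
Team D n = Vec D n → Set

extend : {D : Set} {n : ℕ} → Team D n → D → Team D (suc n)
extend X d (e ∷ g) = e ≡ d × X g

_⊆ₜ_ : {D : Set} {n : ℕ} → Team D n → Team D n → Set
Y ⊆ₜ X = ∀ g → Y g → X g

-- Support semantics; a model in the empty vocabulary is just its domain D.
supports : (D : Set) {n : ℕ} → Team D n → InqBT n → Set₁
supports D X (ident i j) = Lift _ (∀ g → X g → lookup g i ≡ lookup g j)
supports D X bot         = Lift _ (∀ g → ¬ X g)
supports D X (φ ∧ᵢ ψ)    = supports D X φ × supports D X ψ
supports D X (φ ⊻ᵢ ψ)    = supports D X φ ⊎ supports D X ψ
supports D X (φ ⇒ᵢ ψ)    = (Y : Team D _) → Y ⊆ₜ X → supports D Y φ → supports D Y ψ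
supports D X (allᵢ φ)    = (d : D) → supports D (extend X d) φ
supports D X (exiᵢ φ)    = Σ D (λ d → supports D (extend X d) φ)

data FO (n : ℕ) : Set where
  R     : Fin n → Fin n → FO n
  ident : Fin n → Fin n → FO n
  bot   : FO n
  _∧ᶠ_  : FO n → FO n → FO n
  _∨ᶠ_  : FO n → FO n → FO n
  _⇒ᶠ_  : FO n → FO n → FO n
  allᶠ  : FO (suc n) → FO n
  exiᶠ  : FO (suc n) → FO n

sat : (D : Set) (Rel : D → D → Set) {n : ℕ} → Vec D n → FO n → Set
sat D Rel g (R i j)     = Rel (lookup g i) (lookup g j)
sat D Rel g (ident i j) = lookup g i ≡ lookup g j
sat D Rel g bot         = ⊥
sat D Rel g (φ ∧ᶠ ψ)    = sat D Rel g φ × sat D Rel g ψ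
sat D Rel g (φ ∨ᶠ ψ)    = sat D Rel g φ ⊎ sat D Rel g ψ
sat D Rel g (φ ⇒ᶠ ψ)    = sat D Rel g φ → sat D Rel g ψ
sat D Rel g (allᶠ φ)    = (d : D) → sat D Rel (d ∷ g) φ
sat D Rel g (exiᶠ φ)    = Σ D (λ d → sat D Rel (d ∷ g) φ)

vx vy : Fin 2
vx = zero
vy = suc zero

teamRel : {D : Set} → Team D 2 → D → D → Set
teamRel {D} X a b = Σ (Vec D 2) (λ g → X g × lookup g vx ≡ a × lookup g vy ≡ b)

{-# OPTIONS --safe #-}
module Submission where

-- On the full team D × D, a subteam supporting the antecedent of
-- dedekindFinite is the graph of an injective function on part of D whose
-- range misses a point, and the consequent says that the function is not
-- total. So the full team supports dedekindFinite when D is finite, but not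
-- when D = ℕ (take the successor graph). However, the full team gives R the
-- total relation, so a first-order sentence φ*(R) sees only the equalities
-- in D. A back-and-forth argument shows that a sentence of quantifier rank q
-- has the same truth value in every set with at least q elements, in
-- particular in Fin (suc q) and in ℕ.

open import Defs
open import Level using (lift; lower)
open import Data.Empty using (⊥; ⊥-elim)
open import Data.Fin using (Fin; zero; suc; punchOut; _≟_)
open import Data.Fin.Properties using (any?; ¬∀⟶∃¬; <⇒notInjective; punchOut-injective)
open import Data.Nat using (ℕ; suc; pred; _+_; _⊔_; _≤_; _<_; s≤s)
open import Data.Nat.Properties
  using (≤-trans; +-suc; m≤m+n; m≤n+m; 1+n≰n; +-monoʳ-≤; m≤m⊔n; m≤n⊔m; n≤1+n; n<1+n; 0≢1+n)
  renaming (_≟_ to _≟ℕ_)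
open import Data.Product using (Σ; ∃; _×_; _,_; proj₁; proj₂)
open import Data.Product.Function.NonDependent.Propositional using (_×-⇔_)
open import Data.Sum.Function.Propositional using (_⊎-⇔_)
open import Data.Unit using (⊤; tt)
open import Data.Vec using (Vec; []; _∷_; lookup; sum)
open import Function using (_∘_)
open import Function.Bundles using (_⇔_; mk⇔; Equivalence)
open import Function.Construct.Identity using (⇔-id)
open import Function.Construct.Symmetry using (⇔-sym)
open import Function.Definitions using (Injective)
open import Function.Related.TypeIsomorphisms using (→-cong-⇔)
open import Relation.Binary.Definitions using (DecidableEquality)
open import Relation.Binary.PropositionalEquality using (_≡_; _≢_; refl; sym; trans; cong; subst)
open import Relation.Nullary using (¬_; ¬?; yes; no)
open import Relation.Nullary.Decidable using (_×-dec_)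

open Equivalence using (to; from)

private
  variable
    A B D : Set
    m n K : ℕ

quantifierRank : FO m → ℕ
quantifierRank (R i j)     = 0
quantifierRank (ident i j) = 0
quantifierRank bot         = 0
quantifierRank (φ ∧ᶠ ψ)    = quantifierRank φ ⊔ quantifierRank ψ
quantifierRank (φ ∨ᶠ ψ)    = quantifierRank φ ⊔ quantifierRank ψ
quantifierRank (φ ⇒ᶠ ψ)    = quantifierRank φ ⊔ quantifierRank ψ
quantifierRank (allᶠ φ)    = suc (quantifierRank φ)
quantifierRank (exiᶠ φ)    = suc (quantifierRank φ)

FreshFor : Vec A m → A → Set
FreshFor g e = ∀ i → lookup g i ≢ e

HasAtLeast : ℕ → Set → Set
HasAtLeast K A = ∀ {m} (g : Vec A m) → m < K → ∃ (FreshFor g)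

Fin-hasAtLeast : HasAtLeast K (Fin K)
Fin-hasAtLeast {K} g m<K =
  let e , missed = ¬∀⟶∃¬ K _ (λ e → any? (λ i → lookup g i ≟ e)) covering-impossible
  in e , λ i eq → missed (i , eq)
  where
  covering-impossible : ¬ (∀ e → ∃ λ i → lookup g i ≡ e)
  covering-impossible cover = <⇒notInjective {f = proj₁ ∘ cover} m<K λ {e} {e′} eq →
    trans (sym (proj₂ (cover e))) (trans (cong (lookup g) eq) (proj₂ (cover e′)))

lookup≤sum : (g : Vec ℕ m) (i : Fin m) → lookup g i ≤ sum g
lookup≤sum (a ∷ g) zero    = m≤m+n a (sum g)
lookup≤sum (a ∷ g) (suc i) = ≤-trans (lookup≤sum g i) (m≤n+m (sum g) a)

ℕ-hasAtLeast : HasAtLeast K ℕ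
ℕ-hasAtLeast g _ = suc (sum g) , λ i eq → 1+n≰n (subst (_≤ sum g) eq (lookup≤sum g i))

record _≃ₑ_ (g : Vec A m) (g′ : Vec B m) : Set where
  constructor mk≃ₑ
  field equalities : ∀ i j → (lookup g i ≡ lookup g j) ⇔ (lookup g′ i ≡ lookup g′ j)

open _≃ₑ_

[]-≃ₑ : _≃ₑ_ {A = A} {B = B} [] []
[]-≃ₑ = mk≃ₑ λ ()

≃ₑ-sym : {g : Vec A m} {g′ : Vec B m} → g ≃ₑ g′ → g′ ≃ₑ g
≃ₑ-sym e = mk≃ₑ λ i j → ⇔-sym (equalities e i j)

∷-≃ₑ : {g : Vec A m} {g′ : Vec B m} {d : A} {d′ : B} → g ≃ₑ g′ →
       (∀ j → (d ≡ lookup g j) ⇔ (d′ ≡ lookup g′ j)) → (d ∷ g) ≃ₑ (d′ ∷ g′)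
∷-≃ₑ e new = mk≃ₑ λ where
  zero    zero    → mk⇔ (λ _ → refl) (λ _ → refl)
  zero    (suc j) → new j
  (suc i) zero    → mk⇔ (sym ∘ to (new i) ∘ sym) (sym ∘ from (new i) ∘ sym)
  (suc i) (suc j) → equalities e i j

-- A new element equal to an old one is matched by its partner, any other by a fresh element.
≃ₑ-extend : DecidableEquality A → HasAtLeast K B → {g : Vec A m} {g′ : Vec B m} →
            m < K → g ≃ₑ g′ → (d : A) → ∃ λ d′ → (d ∷ g) ≃ₑ (d′ ∷ g′)
≃ₑ-extend _≟ᴬ_ B≥K {g} {g′} m<K e d with any? (λ i → lookup g i ≟ᴬ d)
... | yes (i , refl) = lookup g′ i , ∷-≃ₑ e (equalities e i)
... | no ¬old with B≥K g′ m<K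
...   | d′ , fresh = d′ , ∷-≃ₑ e λ j →
          mk⇔ (λ eq → ⊥-elim (¬old (j , sym eq))) (λ eq → ⊥-elim (fresh j (sym eq)))

≤-⊔ˡ : ∀ m {p q} → m + (p ⊔ q) ≤ K → m + p ≤ K
≤-⊔ˡ m {p} {q} = ≤-trans (+-monoʳ-≤ m (m≤m⊔n p q))

≤-⊔ʳ : ∀ m {p q} → m + (p ⊔ q) ≤ K → m + q ≤ K
≤-⊔ʳ m {p} {q} = ≤-trans (+-monoʳ-≤ m (m≤n⊔m p q))

≤-suc-shift : ∀ m {q} → m + suc q ≤ K → suc m + q ≤ K
≤-suc-shift {K} m {q} = subst (_≤ K) (+-suc m q)

≤-suc⇒< : ∀ m {q} → m + suc q ≤ K → m < K
≤-suc⇒< m {q} b = ≤-trans (s≤s (m≤m+n m q)) (≤-suc-shift m b)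

module _ {A B : Set} {K : ℕ} (_≟ᴬ_ : DecidableEquality A) (_≟ᴮ_ : DecidableEquality B)
         (A≥K : HasAtLeast K A) (B≥K : HasAtLeast K B)
         {RA : A → A → Set} {RB : B → B → Set}
         (RA-total : ∀ a a′ → RA a a′) (RB-total : ∀ b b′ → RB b b′) where

  private
    forth : ∀ {q} {g : Vec A m} {g′ : Vec B m} → m + suc q ≤ K → g ≃ₑ g′ →
            (d : A) → ∃ λ d′ → (d ∷ g) ≃ₑ (d′ ∷ g′)
    forth b = ≃ₑ-extend _≟ᴬ_ B≥K (≤-suc⇒< _ b)

    back : ∀ {q} {g : Vec A m} {g′ : Vec B m} → m + suc q ≤ K → g ≃ₑ g′ →
           (d′ : B) → ∃ λ d → (d ∷ g) ≃ₑ (d′ ∷ g′)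
    back b e d′ = let d , e′ = ≃ₑ-extend _≟ᴮ_ A≥K (≤-suc⇒< _ b) (≃ₑ-sym e) d′ in d , ≃ₑ-sym e′

  sat-≃ₑ : (φ : FO m) {g : Vec A m} {g′ : Vec B m} →
           m + quantifierRank φ ≤ K → g ≃ₑ g′ → sat A RA g φ ⇔ sat B RB g′ φ
  sat-≃ₑ (R i j)        _ _ = mk⇔ (λ _ → RB-total _ _) (λ _ → RA-total _ _)
  sat-≃ₑ (ident i j)    _ e = equalities e i j
  sat-≃ₑ bot            _ _ = ⇔-id _
  sat-≃ₑ {m} (φ ∧ᶠ ψ)   b e = sat-≃ₑ φ (≤-⊔ˡ m b) e ×-⇔ sat-≃ₑ ψ (≤-⊔ʳ m b) e
  sat-≃ₑ {m} (φ ∨ᶠ ψ)   b e = sat-≃ₑ φ (≤-⊔ˡ m b) e ⊎-⇔ sat-≃ₑ ψ (≤-⊔ʳ m b) e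
  sat-≃ₑ {m} (φ ⇒ᶠ ψ)   b e = →-cong-⇔ (sat-≃ₑ φ (≤-⊔ˡ m b) e) (sat-≃ₑ ψ (≤-⊔ʳ m b) e)
  sat-≃ₑ {m} (allᶠ φ)   b e = mk⇔
    (λ s d′ → let d , e′ = back b e d′ in to (sat-≃ₑ φ (≤-suc-shift m b) e′) (s d))
    (λ s d → let d′ , e′ = forth b e d in from (sat-≃ₑ φ (≤-suc-shift m b) e′) (s d′))
  sat-≃ₑ {m} (exiᶠ φ)   b e = mk⇔
    (λ (d , s) → let d′ , e′ = forth b e d in d′ , to (sat-≃ₑ φ (≤-suc-shift m b) e′) s)
    (λ (d′ , s) → let d , e′ = back b e d′ in d , from (sat-≃ₑ φ (≤-suc-shift m b) e′) s)

  sat-sentence : (φ : FO 0) → quantifierRank φ ≤ K → sat A RA [] φ ⇔ sat B RB [] φ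
  sat-sentence φ b = sat-≃ₑ φ b []-≃ₑ

record Flat {D : Set} {n : ℕ} (ψ : InqBT n) (P : Vec D n → Set) : Set₁ where
  constructor mkFlat
  field supports-flat : ∀ {Y} → supports D Y ψ ⇔ (∀ g → Y g → P g)

open Flat

ident-flat : {i j : Fin n} → Flat {D = D} (ident i j) (λ g → lookup g i ≡ lookup g j)
ident-flat = mkFlat (mk⇔ lower lift)

bot-flat : Flat {D = D} {n = n} bot (λ _ → ⊥)
bot-flat = mkFlat (mk⇔ lower lift)

supports-⇒-flat : {T : Team D n} {i j : Fin n} {ψ : InqBT n} {P : Vec D n → Set} → Flat ψ P →
                  supports D T (ident i j ⇒ᵢ ψ) ⇔ (∀ g → T g → lookup g i ≡ lookup g j → P g)
supports-⇒-flat {D = D} {n} {T} {i} {j} ψ-flat = mk⇔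
  (λ s g t eq → to (supports-flat ψ-flat) (s T∩[i≡j] (λ _ → proj₁) (lift λ _ → proj₂)) g (t , eq))
  (λ H Y Y⊆T (lift eqs) → from (supports-flat ψ-flat) λ g y → H g (Y⊆T g y) (eqs g y))
  where
  T∩[i≡j] : Team D n
  T∩[i≡j] g = T g × lookup g i ≡ lookup g j

-- The dependence atom =(i, j), i.e. ∀u ∃w (i = u → j = w), and ∃w ¬(i = w).
dependence : Fin n → Fin n → InqBT n
dependence i j = allᵢ (exiᵢ (ident (suc (suc i)) (suc zero) ⇒ᵢ ident (suc (suc j)) zero))

omitsValue : Fin n → InqBT n
omitsValue i = exiᵢ (ident (suc i) zero ⇒ᵢ bot)

supports-dependence : {Y : Team D n} {i j : Fin n} →
                      supports D Y (dependence i j) ⇔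
                      Σ (D → D) λ f → ∀ g → Y g → lookup g j ≡ f (lookup g i)
supports-dependence = mk⇔
  (λ s → (λ u → proj₁ (s u)) , λ g y →
    to (supports-⇒-flat ident-flat) (proj₂ (s _)) (_ ∷ _ ∷ g) (refl , refl , y) refl)
  (λ (f , H) u → f u , from (supports-⇒-flat ident-flat) λ where
    (_ ∷ _ ∷ g) (refl , refl , y) refl → H g y)

supports-omitsValue : {Y : Team D n} {i : Fin n} →
                      supports D Y (omitsValue i) ⇔ Σ D λ r → ∀ g → Y g → lookup g i ≢ r
supports-omitsValue = mk⇔
  (λ (r , s) → r , λ g y → to (supports-⇒-flat bot-flat) s (r ∷ g) (refl , y))
  (λ (r , H) → r , from (supports-⇒-flat bot-flat) λ where
    (_ ∷ g) (refl , y) → H g y)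

dedekindFinite : InqBT 2
dedekindFinite = (dependence vx vy ∧ᵢ (dependence vy vx ∧ᵢ omitsValue vy)) ⇒ᵢ omitsValue vx

fullTeam : Team D 2
fullTeam _ = ⊤

teamRel-fullTeam : (a b : D) → teamRel fullTeam a b
teamRel-fullTeam a b = (a ∷ b ∷ []) , tt , refl , refl

graph : (D → D) → Team D 2
graph f g = lookup g vy ≡ f (lookup g vx)

Fin-injective-endo-hits : (f : Fin n → Fin n) → Injective _≡_ _≡_ f → (r : Fin n) → ¬ (∀ d → f d ≢ r)
Fin-injective-endo-hits {suc n} f f-inj r misses =
  <⇒notInjective {f = λ d → punchOut (avoids d)} (n<1+n n) λ eq →
    f-inj (punchOut-injective (avoids _) (avoids _) eq)
  where
  avoids : ∀ d → r ≢ f d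
  avoids d = misses d ∘ sym

Fin-partialInjection-omitsValue :
  {Y : Team (Fin n) 2} (f h : Fin n → Fin n) (r : Fin n) →
  (∀ g → Y g → lookup g vy ≡ f (lookup g vx)) →
  (∀ g → Y g → lookup g vx ≡ h (lookup g vy)) →
  (∀ g → Y g → lookup g vy ≢ r) →
  Σ (Fin n) λ d → ∀ g → Y g → lookup g vx ≢ d
Fin-partialInjection-omitsValue {n} {Y} f h r y≡fx x≡hy y≢r =
  let d , ¬good = ¬∀⟶∃¬ n Good (λ d → (h (f d) ≟ d) ×-dec ¬? (f d ≟ r)) not-all-good
  in d , λ g y x≡d → ¬good (subst Good x≡d (good g y))
  where
  Good : Fin n → Set
  Good d = h (f d) ≡ d × f d ≢ r

  good : ∀ g → Y g → Good (lookup g vx)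
  good g y = sym (trans (x≡hy g y) (cong h (y≡fx g y))) , λ fx≡r → y≢r g y (trans (y≡fx g y) fx≡r)

  not-all-good : ¬ (∀ d → Good d)
  not-all-good all-good = Fin-injective-endo-hits f f-inj r (proj₂ ∘ all-good)
    where
    f-inj : Injective _≡_ _≡_ f
    f-inj {d} {d′} eq = trans (sym (proj₁ (all-good d))) (trans (cong h eq) (proj₁ (all-good d′)))


Fin-supports-dedekindFinite : supports (Fin n) fullTeam dedekindFinite
Fin-supports-dedekindFinite Y _ (functional , injective , notSurjective) =
  let f , y≡fx = to supports-dependence functional
      h , x≡hy = to supports-dependence injective
      r , y≢r  = to supports-omitsValue notSurjective
  in from supports-omitsValue (Fin-partialInjection-omitsValue f h r y≡fx x≡hy y≢r)

dedekindInfinite-refutes : (f h : D → D) → (∀ d → h (f d) ≡ d) → (r : D) → (∀ d → f d ≢ r) →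
                           ¬ supports D fullTeam dedekindFinite
dedekindInfinite-refutes f h hf≡id r misses s =
  let d , x≢d = to supports-omitsValue (s (graph f) (λ _ _ → tt) (functional , injective , notSurjective))
  in x≢d (d ∷ f d ∷ []) refl refl
  where
  functional : supports _ (graph f) (dependence vx vy)
  functional = from supports-dependence (f , λ _ y → y)
  injective : supports _ (graph f) (dependence vy vx)
  injective = from supports-dependence (h , λ g y → trans (sym (hf≡id _)) (cong h (sym y)))
  notSurjective : supports _ (graph f) (omitsValue vy)
  notSurjective = from supports-omitsValue (r , λ g y y≡r → misses _ (trans (sym y) y≡r))

ℕ-refutes-dedekindFinite : ¬ supports ℕ fullTeam dedekindFinite
ℕ-refutes-dedekindFinite = dedekindInfinite-refutes suc pred (λ _ → refl) 0 (λ _ → 0≢1+n ∘ sym)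

theorem2 : Σ (InqBT 2) (λ φ →
               ¬ Σ (FO 0) (λ φ* →
                 (D : Set) → D → (X : Team D 2) →
                   (supports D X φ → sat D (teamRel X) [] φ*) ×
                   (sat D (teamRel X) [] φ* → supports D X φ)))
theorem2 = dedekindFinite , λ (φ* , φ*-defines) →
  let q = quantifierRank φ*
      Fin-agrees-with-ℕ = sat-sentence _≟_ _≟ℕ_ Fin-hasAtLeast ℕ-hasAtLeast
                            teamRel-fullTeam teamRel-fullTeam φ* (n≤1+n q)
      sat-Fin = proj₁ (φ*-defines (Fin (suc q)) zero fullTeam) Fin-supports-dedekindFinite
  in ℕ-refutes-dedekindFinite (proj₂ (φ*-defines ℕ 0 fullTeam) (to Fin-agrees-with-ℕ sat-Fin))
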